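{- Let $\Gamma$ be an instance of Satisfiability (a Boolean formula in conjunctive normal form) with variables $x_1,\ldots,x_n$ and clauses $c_1,\ldots,c_m$ such that every clause contains two or three literals, every positive literal appears in at most two different clauses, every negative literal appears in at most one clause, and no clause contains a literal and its negation. For $j\in[m]$ let $|c_j|$ be the number of literals in $c_j$. Let $G$ be the graph obtained as follows: take $n$ disjoint triangles with vertex sets $X_i=\{t_i,f_i,u_i\}$, $i\in[n]$, and $m$ disjoint cliques with vertex sets $C_1,\ldots,C_m$ (disjoint from the triangles), where $|C_j|=|c_j|+1$; in each $C_j$ identify $|c_j|$ of its vertices with the literals of $c_j$ (one vertex per literal occurrence), and let $v_j$ be the remaining vertex of $C_j$. Then, for every $i\in[n]$, join $f_i$ by an edge to every vertex of $\bigcup_{j=1}^m C_j$ identified with the literal $x_i$, and join $t_i$ by an edge to every vertex of $\bigcup_{j=1}^m C_j$ identified with the literal $\bar{x}_i$. Then $\nu_{ac}(G)=n+m$.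
   Context: For a graph $G$ and a matching $M$ in $G$, $G(M)$ is the subgraph of $G$ induced by the set of vertices covered by $M$. A matching $M$ is acyclic if $G(M)$ is a forest; $\nu_{ac}(G)$ is the maximum cardinality of an acyclic matching in $G$. $[k]=\{1,\ldots,k\}$. -}

module Defs where

open import Data.Nat using (ℕ; zero; suc; _+_; _≤_; _≥_)
open import Data.Fin using (Fin; zero; suc)
open import Data.Bool using (Bool; true; false)
open import Data.List using (List; []; _∷_; length; lookup; concatMap)
open import Data.List.Membership.Propositional using (_∈_)
open import Data.List.Relation.Unary.All using (All)
open import Data.List.Relation.Unary.Unique.Propositional using (Unique)
open import Data.Product using (Σ; _×_; _,_; ∃)
open import Data.Sum using (_⊎_)
open import Relation.Binary.PropositionalEquality using (_≡_; _≢_)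
open import Relation.Nullary using (¬_)

endpoints : {V : Set} → List (V × V) → List V
endpoints = concatMap (λ { (u , v) → u ∷ v ∷ [] })

record IsMatching {V : Set} (Adj : V → V → Set) (M : List (V × V)) : Set where
  field
    edges    : All (λ e → Adj (Data.Product.proj₁ e) (Data.Product.proj₂ e)) M
    disjoint : Unique (endpoints M)

data Path {V : Set} (Adj : V → V → Set) : V → List V → V → Set where
  single : ∀ v → Path Adj v (v ∷ []) v
  step   : ∀ {u w ws x} → Adj u w → Path Adj w ws x → Path Adj u (u ∷ ws) x

record Cycle {V : Set} (Adj : V → V → Set) (S : V → Set) : Set where
  field
    first last : V
    verts      : List V
    path       : Path Adj first verts last
    closing    : Adj last first
    long       : length verts ≥ 3
    distinct   : Unique verts
    inside     : All S verts

IsAcyclicMatching : {V : Set} (Adj : V → V → Set) → List (V × V) → Set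
IsAcyclicMatching Adj M =
  IsMatching Adj M × ¬ Cycle Adj (λ v → v ∈ endpoints M)

νac≡ : {V : Set} (Adj : V → V → Set) → ℕ → Set
νac≡ {V} Adj k =
  (Σ (List (V × V)) λ M → IsAcyclicMatching Adj M × length M ≡ k)
  × (∀ M → IsAcyclicMatching Adj M → length M ≤ k)

-- CNF formulas: variables Fin n, literal (i , true) = x_i,
-- (i , false) = ¬x_i; clauses c_1..c_m given as lists of literals.

Literal : ℕ → Set
Literal n = Fin n × Bool

CNF : ℕ → ℕ → Set
CNF n m = Fin m → List (Literal n)

record Restricted {n m : ℕ} (Γ : CNF n m) : Set where
  field
    clauseSet   : ∀ j → Unique (Γ j)
    size23      : ∀ j → length (Γ j) ≡ 2 ⊎ length (Γ j) ≡ 3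
    posAtMost2  : ∀ i j₁ j₂ j₃ → (i , true) ∈ Γ j₁ → (i , true) ∈ Γ j₂ →
                  (i , true) ∈ Γ j₃ → j₁ ≡ j₂ ⊎ j₁ ≡ j₃ ⊎ j₂ ≡ j₃
    negAtMost1  : ∀ i j₁ j₂ → (i , false) ∈ Γ j₁ → (i , false) ∈ Γ j₂ → j₁ ≡ j₂
    noComplement : ∀ j i → ¬ ((i , true) ∈ Γ j × (i , false) ∈ Γ j)

-- Triangle vertices: (i , 0) = t_i , (i , 1) = f_i , (i , 2) = u_i.
-- Clique C_j vertices: (j , zero) = v_j, (j , suc k) = the vertex
-- identified with the k-th literal occurrence of c_j.

data Vertex {n m : ℕ} (Γ : CNF n m) : Set where
  tri    : Fin n → Fin 3 → Vertex Γ
  clique : (j : Fin m) → Fin (suc (length (Γ j))) → Vertex Γ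

t f : ∀ {n m} {Γ : CNF n m} → Fin n → Vertex Γ
t i = tri i zero
f i = tri i (suc zero)

data Edge {n m : ℕ} (Γ : CNF n m) : Vertex Γ → Vertex Γ → Set where
  triangle : ∀ i {a b} → a ≢ b → Edge Γ (tri i a) (tri i b)
  inClique : ∀ j {a b} → a ≢ b → Edge Γ (clique j a) (clique j b)
  posLit   : ∀ i j k → lookup (Γ j) k ≡ (i , true) →
             Edge Γ (f i) (clique j (suc k))
  negLit   : ∀ i j k → lookup (Γ j) k ≡ (i , false) →
             Edge Γ (t i) (clique j (suc k))

Adj : ∀ {n m} (Γ : CNF n m) → Vertex Γ → Vertex Γ → Set
Adj Γ u v = Edge Γ u v ⊎ Edge Γ v u

module Submission where

-- Choose one literal vertex ℓ_j in every clique C_j. The matching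
-- {t_i u_i} ∪ {v_j ℓ_j} has n + m edges and is acyclic, since a vertex on a
-- cycle has two neighbours on it: u_i and v_j have only one neighbour in
-- G(M), so they are off every cycle; then ℓ_j has at most one neighbour left
-- (the t_i of the variable its literal negates, if any), and finally t_i has
-- none. Conversely, a triangle X_i or a clique C_j containing three vertices
-- of G(M) would span a triangle in G(M), so each of these n + m blocks
-- contains at most two of the 2|M| matched vertices.

open import Defs
open import Data.Nat using (ℕ; zero; suc; _+_; _*_; _≤_; z≤n; s≤s)
open import Data.Nat.Properties using (+-suc; *-suc; +-mono-≤; *-cancelˡ-≤; module ≤-Reasoning)
open import Data.Fin using (Fin; zero; suc; join; splitAt)
open import Data.Fin.Properties using (join-splitAt; splitAt-join) renaming (_≟_ to _≟ᶠ_)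
open import Data.List using (List; []; _∷_; length; map; filter; lookup; allFin)
open import Data.List.Properties using (length-map; length-tabulate)
open import Data.List.Membership.Propositional using (_∈_; _∉_)
open import Data.List.Membership.Propositional.Properties using (∈-filter⁻; ∈-allFin)
open import Data.List.Relation.Unary.All as All using (All; []; _∷_)
open import Data.List.Relation.Unary.All.Properties using (map⁺)
open import Data.List.Relation.Unary.Any using (here; there)
open import Data.List.Relation.Unary.AllPairs using ([]; _∷_)
open import Data.List.Relation.Unary.Unique.Propositional using (Unique)
open import Data.List.Relation.Unary.Unique.Propositional.Properties using (filter⁺; allFin⁺)
open import Data.Product using (∃-syntax; _×_; _,_; proj₁; proj₂)
open import Data.Sum using (_⊎_; inj₁; inj₂)
open import Data.Empty using (⊥; ⊥-elim)
open import Function using (_∘_)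
open import Relation.Nullary using (¬_; yes; no; ¬?)
open import Relation.Unary using (Decidable)
open import Relation.Binary.Definitions using (Symmetric; DecidableEquality)
open import Relation.Binary.PropositionalEquality
  using (_≡_; _≢_; refl; sym; trans; cong; subst; module ≡-Reasoning)

module _ {V : Set} {A : V → V → Set} where

  head∈path : ∀ {a ws b} → Path A a ws b → a ∈ ws
  head∈path (single _) = here refl
  head∈path (step _ _) = here refl

  last∈path : ∀ {a ws b} → Path A a ws b → b ∈ ws
  last∈path (single _) = here refl
  last∈path (step _ p) = there (last∈path p)

  predecessor-of-last : ∀ {a w ws b} → A a w → Path A w ws b → ∃[ p ] (p ∈ a ∷ ws × A p b)
  predecessor-of-last a~w (single _)   = _ , here refl , a~w
  predecessor-of-last _   (step w~ p) with predecessor-of-last w~ p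
  ... | q , q∈ , q~b = q , there q∈ , q~b

  record TwoNeighboursIn (ws : List V) (x : V) : Set where
    constructor neighbours
    field
      {left right} : V
      left∈      : left ∈ ws
      right∈     : right ∈ ws
      left≢right : left ≢ right
      x~left     : A x left
      x~right    : A x right

  AtMostOneNeighbourIn : List V → V → Set
  AtMostOneNeighbourIn ws x = ∀ {p q} → p ∈ ws → q ∈ ws → A x p → A x q → p ≡ q

  module _ (sym-A : Symmetric A) where

    inner-vertex-neighbours : ∀ {a ws b x} → Path A a ws b → Unique ws → x ∈ ws → x ≢ a →
                              x ≡ b ⊎ TwoNeighboursIn ws x
    inner-vertex-neighbours (single _) _ (here refl) x≢a = ⊥-elim (x≢a refl)
    inner-vertex-neighbours (step _ _) _ (here refl) x≢a = ⊥-elim (x≢a refl)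
    inner-vertex-neighbours (single _) _ (there ())
    inner-vertex-neighbours (step _ (single _)) _ (there (here refl)) _ = inj₁ refl
    inner-vertex-neighbours (step a~x (step x~s p)) (a∉ ∷ _) (there (here refl)) _ =
      inj₂ (neighbours (here refl) (there (there (head∈path p)))
                       (All.lookup a∉ (there (head∈path p))) (sym-A a~x) x~s)
    inner-vertex-neighbours (step _ (single _)) _ (there (there ()))
    inner-vertex-neighbours (step _ p@(step _ _)) (_ ∷ w∉ ∷ u) (there (there x∈)) _
      with inner-vertex-neighbours p (w∉ ∷ u) (there x∈) (λ x≡w → All.lookup w∉ x∈ (sym x≡w))
    ... | inj₁ x≡b = inj₁ x≡b
    ... | inj₂ (neighbours l∈ r∈ l≢r x~l x~r) =
      inj₂ (neighbours (there l∈) (there r∈) l≢r x~l x~r)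

    cycle-vertex-neighbours : ∀ {S} (C : Cycle A S) {x} → x ∈ Cycle.verts C →
                              TwoNeighboursIn (Cycle.verts C) x
    cycle-vertex-neighbours record { path = single _ ; long = s≤s () }
    cycle-vertex-neighbours record { path = step _ (single _) ; long = s≤s (s≤s ()) }
    cycle-vertex-neighbours
      record { path = P@(step a~w (step w~ q)) ; closing = b~a ; distinct = U@(a∉ ∷ w∉ ∷ _) } x∈
      with x∈
    ... | here refl =
      neighbours (there (here refl)) (last∈path P) (All.lookup w∉ (last∈path q)) a~w (sym-A b~a)
    ... | there x∈′
      with inner-vertex-neighbours P U (there x∈′) (λ x≡a → All.lookup a∉ x∈′ (sym x≡a))
    ...   | inj₂ two = two
    ...   | inj₁ refl with predecessor-of-last w~ q
    ...     | p , p∈ , p~b =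
      neighbours (here refl) (there p∈) (All.lookup a∉ p∈) b~a (sym-A p~b)

    cycle-has-no-pendant-vertex : ∀ {S} (C : Cycle A S) {x} → x ∈ Cycle.verts C →
                                  ¬ AtMostOneNeighbourIn (Cycle.verts C) x
    cycle-has-no-pendant-vertex C x∈ pendant with cycle-vertex-neighbours C x∈
    ... | neighbours l∈ r∈ l≢r x~l x~r = l≢r (pendant l∈ r∈ x~l x~r)

  triangle-cycle : ∀ {S : V → Set} {a b c} → A a b → A b c → A c a → a ≢ b → a ≢ c → b ≢ c →
                   S a → S b → S c → Cycle A S
  triangle-cycle {c = c} a~b b~c c~a a≢b a≢c b≢c a∈ b∈ c∈ = record
    { path     = step a~b (step b~c (single c))
    ; closing  = c~a
    ; long     = s≤s (s≤s (s≤s z≤n))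
    ; distinct = (a≢b ∷ a≢c ∷ []) ∷ (b≢c ∷ []) ∷ [] ∷ []
    ; inside   = a∈ ∷ b∈ ∷ c∈ ∷ []
    }

module _ {V : Set} where

  All-endpoints : ∀ {P : V → Set} (M : List (V × V)) →
                  All (λ e → P (proj₁ e) × P (proj₂ e)) M → All P (endpoints M)
  All-endpoints []      []            = []
  All-endpoints (_ ∷ M) ((a , b) ∷ r) = a ∷ b ∷ All-endpoints M r

  length-endpoints : ∀ (M : List (V × V)) → length (endpoints M) ≡ 2 * length M
  length-endpoints []      = refl
  length-endpoints (_ ∷ M) =
    trans (cong (λ k → suc (suc k)) (length-endpoints M)) (sym (*-suc 2 (length M)))

  Unique-endpoints-map : ∀ {X : Set} (e : X → V × V) (key : V → X) →
    (∀ x → key (proj₁ (e x)) ≡ x) → (∀ x → key (proj₂ (e x)) ≡ x) →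
    (∀ x → proj₁ (e x) ≢ proj₂ (e x)) →
    ∀ {xs} → Unique xs → Unique (endpoints (map e xs))
  Unique-endpoints-map e key key₁ key₂ e₁≢e₂ {[]} [] = []
  Unique-endpoints-map e key key₁ key₂ e₁≢e₂ {x ∷ xs} (x∉ ∷ u) =
    (e₁≢e₂ x ∷ All-endpoints (map e xs) (map⁺ (All.map (apart (key₁ x)) x∉)))
    ∷ All-endpoints (map e xs) (map⁺ (All.map (apart (key₂ x)) x∉))
    ∷ Unique-endpoints-map e key key₁ key₂ e₁≢e₂ u
    where
      distinct-keys : ∀ {a b y} → key a ≡ x → key b ≡ y → x ≢ y → a ≢ b
      distinct-keys ka kb x≢y a≡b = x≢y (trans (sym ka) (trans (cong key a≡b) kb))
      apart : ∀ {a y} → key a ≡ x → x ≢ y → a ≢ proj₁ (e y) × a ≢ proj₂ (e y)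
      apart ka x≢y = distinct-keys ka (key₁ _) x≢y , distinct-keys ka (key₂ _) x≢y

length-filter-split : ∀ {X : Set} {P : X → Set} (P? : Decidable P) xs →
                      length xs ≡ length (filter P? xs) + length (filter (¬? ∘ P?) xs)
length-filter-split P? [] = refl
length-filter-split P? (x ∷ xs) with P? x
... | yes _ = cong suc (length-filter-split P? xs)
... | no  _ = trans (cong suc (length-filter-split P? xs)) (sym (+-suc _ _))

module _ {V B : Set} (block : V → B) (_≟_ : DecidableEquality B) where

  NoThreeInOneBlock : List V → Set
  NoThreeInOneBlock S = ∀ {a b c} → a ∈ S → b ∈ S → c ∈ S → a ≢ b → a ≢ c → b ≢ c →
                        block a ≡ block b → block a ≡ block c → ⊥

  length-one-block≤2 : ∀ {S β xs} → NoThreeInOneBlock S → Unique xs →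
                       (∀ {x} → x ∈ xs → x ∈ S × block x ≡ β) → length xs ≤ 2
  length-one-block≤2 {xs = []}              _ _ _ = z≤n
  length-one-block≤2 {xs = _ ∷ []}          _ _ _ = s≤s z≤n
  length-one-block≤2 {xs = _ ∷ _ ∷ []}      _ _ _ = s≤s (s≤s z≤n)
  length-one-block≤2 {xs = _ ∷ _ ∷ _ ∷ _} no-three ((a≢b ∷ a≢c ∷ _) ∷ (b≢c ∷ _) ∷ _) in-β
    with in-β (here refl) | in-β (there (here refl)) | in-β (there (there (here refl)))
  ... | a∈ , a-β | b∈ , b-β | c∈ , c-β =
    ⊥-elim (no-three a∈ b∈ c∈ a≢b a≢c b≢c (trans a-β (sym b-β)) (trans a-β (sym c-β)))

  length≤2*blocks : ∀ Bs {S} → Unique S → (∀ {x} → x ∈ S → block x ∈ Bs) → NoThreeInOneBlock S →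
                    length S ≤ 2 * length Bs
  length≤2*blocks [] {[]} _ _ _ = z≤n
  length≤2*blocks [] {x ∷ _} _ in-Bs _ with in-Bs (here refl)
  ... | ()
  length≤2*blocks (β ∷ Bs) {S} U in-Bs no-three = begin
    length S                           ≡⟨ length-filter-split in-β? S ⟩
    length inside-β + length outside-β ≤⟨ +-mono-≤ inside-≤2 outside-≤ ⟩
    2 + 2 * length Bs                  ≡⟨ *-suc 2 (length Bs) ⟨
    2 * length (β ∷ Bs)                ∎
    where
      open ≤-Reasoning
      in-β? : Decidable (λ x → block x ≡ β)
      in-β? x = block x ≟ β
      inside-β outside-β : List V
      inside-β  = filter in-β? S
      outside-β = filter (¬? ∘ in-β?) S
      inside-≤2 : length inside-β ≤ 2
      inside-≤2 = length-one-block≤2 no-three (filter⁺ in-β? U) (∈-filter⁻ in-β?)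
      outside⊆S : ∀ {x} → x ∈ outside-β → x ∈ S
      outside⊆S = proj₁ ∘ ∈-filter⁻ (¬? ∘ in-β?)
      outside-in-Bs : ∀ {x} → x ∈ outside-β → block x ∈ Bs
      outside-in-Bs x∈ with ∈-filter⁻ (¬? ∘ in-β?) x∈
      ... | x∈S , x∉β with in-Bs x∈S
      ...   | here  x∈β  = ⊥-elim (x∉β x∈β)
      ...   | there x∈Bs = x∈Bs
      outside-≤ : length outside-β ≤ 2 * length Bs
      outside-≤ = length≤2*blocks Bs (filter⁺ (¬? ∘ in-β?) U) outside-in-Bs
                    (λ a∈ b∈ c∈ → no-three (outside⊆S a∈) (outside⊆S b∈) (outside⊆S c∈))

module _ {n m : ℕ} {Γ : CNF n m} where

  Adj-sym : Symmetric (Adj Γ)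
  Adj-sym (inj₁ e) = inj₂ e
  Adj-sym (inj₂ e) = inj₁ e

  part : Vertex Γ → Fin n ⊎ Fin m
  part (tri i _)    = inj₁ i
  part (clique j _) = inj₂ j

  block : Vertex Γ → Fin (n + m)
  block = join n m ∘ part

  same-part-adjacent : ∀ {a b} → part a ≡ part b → a ≢ b → Adj Γ a b
  same-part-adjacent {tri i _}    {tri .i _}    refl a≢b = inj₁ (triangle i (a≢b ∘ cong (tri i)))
  same-part-adjacent {clique j _} {clique .j _} refl a≢b =
    inj₁ (inClique j (a≢b ∘ cong (clique j)))

  same-block-adjacent : ∀ {a b} → block a ≡ block b → a ≢ b → Adj Γ a b
  same-block-adjacent {a} {b} a≡b = same-part-adjacent (begin
    part a                           ≡⟨ splitAt-join n m (part a) ⟨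
    splitAt n (block a)              ≡⟨ cong (splitAt n) a≡b ⟩
    splitAt n (block b)              ≡⟨ splitAt-join n m (part b) ⟩
    part b                           ∎)
    where open ≡-Reasoning

  acyclic-matching-length≤ : ∀ M → IsAcyclicMatching (Adj Γ) M → length M ≤ n + m
  acyclic-matching-length≤ M (matching , acyclic) = *-cancelˡ-≤ 2 (begin
    2 * length M                ≡⟨ length-endpoints M ⟨
    length (endpoints M)        ≤⟨ length≤2*blocks block _≟ᶠ_ (allFin (n + m)) (IsMatching.disjoint matching)
                                                   (λ _ → ∈-allFin _) no-three ⟩
    2 * length (allFin (n + m)) ≡⟨ cong (2 *_) (length-tabulate {n = n + m} _) ⟩
    2 * (n + m)                 ∎)
    where
      open ≤-Reasoning
      no-three : NoThreeInOneBlock block _≟ᶠ_ (endpoints M)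
      no-three a∈ b∈ c∈ a≢b a≢c b≢c ab-block ac-block = acyclic (triangle-cycle
        (same-block-adjacent ab-block a≢b) (same-block-adjacent (trans (sym ab-block) ac-block) b≢c)
        (same-block-adjacent (sym ac-block) (a≢c ∘ sym)) a≢b a≢c b≢c a∈ b∈ c∈)

module Matching {n m : ℕ} {Γ : CNF n m} (chosen : (j : Fin m) → Fin (length (Γ j))) where

  u : Fin n → Vertex Γ
  u i = tri i (suc (suc zero))

  v : Fin m → Vertex Γ
  v j = clique j zero

  ℓ : Fin m → Vertex Γ
  ℓ j = clique j (suc (chosen j))

  chosen-variable : Fin m → Fin n
  chosen-variable j = proj₁ (lookup (Γ j) (chosen j))

  matched-edge : Fin n ⊎ Fin m → Vertex Γ × Vertex Γ
  matched-edge (inj₁ i) = t i , u i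
  matched-edge (inj₂ j) = v j , ℓ j

  M₀ : List (Vertex Γ × Vertex Γ)
  M₀ = map (matched-edge ∘ splitAt n) (allFin (n + m))

  length-M₀ : length M₀ ≡ n + m
  length-M₀ = trans (length-map _ (allFin (n + m))) (length-tabulate {n = n + m} _)

  M₀-matching : IsMatching (Adj Γ) M₀
  M₀-matching = record
    { edges    = map⁺ (All.universal (edge ∘ splitAt n) (allFin (n + m)))
    ; disjoint = Unique-endpoints-map (matched-edge ∘ splitAt n) block
                   (block-matched-edge proj₁ first) (block-matched-edge proj₂ second)
                   (ends-differ ∘ splitAt n) (allFin⁺ (n + m))
    }
    where
      edge : ∀ s → Adj Γ (proj₁ (matched-edge s)) (proj₂ (matched-edge s))
      edge (inj₁ i) = inj₁ (triangle i λ ())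
      edge (inj₂ j) = inj₁ (inClique j λ ())
      ends-differ : ∀ s → proj₁ (matched-edge s) ≢ proj₂ (matched-edge s)
      ends-differ (inj₁ _) ()
      ends-differ (inj₂ _) ()
      first : ∀ s → part (proj₁ (matched-edge s)) ≡ s
      first (inj₁ _) = refl
      first (inj₂ _) = refl
      second : ∀ s → part (proj₂ (matched-edge s)) ≡ s
      second (inj₁ _) = refl
      second (inj₂ _) = refl
      block-matched-edge : (end : Vertex Γ × Vertex Γ → Vertex Γ) →
                           (∀ s → part (end (matched-edge s)) ≡ s) →
                           ∀ x → block (end (matched-edge (splitAt n x))) ≡ x
      block-matched-edge end part-end x =
        trans (cong (join n m) (part-end (splitAt n x))) (join-splitAt n m x)

  data Matched : Vertex Γ → Set where
    t-matched : ∀ i → Matched (t i)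
    u-matched : ∀ i → Matched (u i)
    v-matched : ∀ j → Matched (v j)
    ℓ-matched : ∀ j → Matched (ℓ j)

  matched : ∀ {y} → y ∈ endpoints M₀ → Matched y
  matched =
    All.lookup (All-endpoints M₀ (map⁺ (All.universal (covered ∘ splitAt n) (allFin (n + m)))))
    where
      covered : ∀ s → Matched (proj₁ (matched-edge s)) × Matched (proj₂ (matched-edge s))
      covered (inj₁ i) = t-matched i , u-matched i
      covered (inj₂ j) = v-matched j , ℓ-matched j

  u-neighbour : ∀ {i y} → Adj Γ (u i) y → Matched y → y ≡ t i
  u-neighbour (inj₁ (triangle _ _))   (t-matched _) = refl
  u-neighbour (inj₂ (triangle _ _))   (t-matched _) = refl
  u-neighbour (inj₁ (triangle _ u≢u)) (u-matched _) = ⊥-elim (u≢u refl)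
  u-neighbour (inj₂ (triangle _ u≢u)) (u-matched _) = ⊥-elim (u≢u refl)

  v-neighbour : ∀ {j y} → Adj Γ (v j) y → Matched y → y ≡ ℓ j
  v-neighbour (inj₁ ()) (t-matched _)
  v-neighbour (inj₂ ()) (t-matched _)
  v-neighbour (inj₁ ()) (u-matched _)
  v-neighbour (inj₂ ()) (u-matched _)
  v-neighbour (inj₁ (inClique _ v≢v)) (v-matched _) = ⊥-elim (v≢v refl)
  v-neighbour (inj₂ (inClique _ v≢v)) (v-matched _) = ⊥-elim (v≢v refl)
  v-neighbour (inj₁ (inClique _ _))   (ℓ-matched _) = refl
  v-neighbour (inj₂ (inClique _ _))   (ℓ-matched _) = refl

  ℓ-neighbour : ∀ {j y} → Adj Γ (ℓ j) y → Matched y → y ≡ v j ⊎ y ≡ t (chosen-variable j)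
  ℓ-neighbour (inj₁ ()) (t-matched _)
  ℓ-neighbour (inj₂ (negLit _ _ _ negated)) (t-matched _) = inj₂ (cong (t ∘ proj₁) (sym negated))
  ℓ-neighbour (inj₁ ()) (u-matched _)
  ℓ-neighbour (inj₁ (inClique _ _))   (v-matched _) = inj₁ refl
  ℓ-neighbour (inj₂ (inClique _ _))   (v-matched _) = inj₁ refl
  ℓ-neighbour (inj₁ (inClique _ ℓ≢ℓ)) (ℓ-matched _) = ⊥-elim (ℓ≢ℓ refl)
  ℓ-neighbour (inj₂ (inClique _ ℓ≢ℓ)) (ℓ-matched _) = ⊥-elim (ℓ≢ℓ refl)

  t-neighbour : ∀ {i y} → Adj Γ (t i) y → Matched y → y ≡ u i ⊎ ∃[ j ] y ≡ ℓ j
  t-neighbour (inj₁ (triangle _ t≢t)) (t-matched _) = ⊥-elim (t≢t refl)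
  t-neighbour (inj₂ (triangle _ t≢t)) (t-matched _) = ⊥-elim (t≢t refl)
  t-neighbour (inj₁ (triangle _ _))   (u-matched _) = inj₁ refl
  t-neighbour (inj₂ (triangle _ _))   (u-matched _) = inj₁ refl
  t-neighbour _ (ℓ-matched j) = inj₂ (j , refl)

  module OnCycle (C : Cycle (Adj Γ) (_∈ endpoints M₀)) where
    open Cycle C

    matched-on-cycle : ∀ {y} → y ∈ verts → Matched y
    matched-on-cycle = matched ∘ All.lookup inside

    no-pendant : ∀ {x} → x ∈ verts → ¬ AtMostOneNeighbourIn {A = Adj Γ} verts x
    no-pendant = cycle-has-no-pendant-vertex Adj-sym C

    u∉cycle : ∀ i → u i ∉ verts
    u∉cycle i u∈ = no-pendant u∈ λ p∈ q∈ u~p u~q →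
      trans (u-neighbour u~p (matched-on-cycle p∈)) (sym (u-neighbour u~q (matched-on-cycle q∈)))

    v∉cycle : ∀ j → v j ∉ verts
    v∉cycle j v∈ = no-pendant v∈ λ p∈ q∈ v~p v~q →
      trans (v-neighbour v~p (matched-on-cycle p∈)) (sym (v-neighbour v~q (matched-on-cycle q∈)))

    ℓ∉cycle : ∀ j → ℓ j ∉ verts
    ℓ∉cycle j ℓ∈ = no-pendant ℓ∈ λ p∈ q∈ ℓ~p ℓ~q →
      trans (negated-variable p∈ ℓ~p) (sym (negated-variable q∈ ℓ~q))
      where
        negated-variable : ∀ {y} → y ∈ verts → Adj Γ (ℓ j) y → y ≡ t (chosen-variable j)
        negated-variable y∈ ℓ~y with ℓ-neighbour ℓ~y (matched-on-cycle y∈)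
        ... | inj₁ refl = ⊥-elim (v∉cycle j y∈)
        ... | inj₂ y≡t  = y≡t

    t∉cycle : ∀ i → t i ∉ verts
    t∉cycle i t∈ = no-pendant t∈ λ p∈ _ t~p _ → ⊥-elim (no-neighbour p∈ t~p)
      where
        no-neighbour : ∀ {y} → y ∈ verts → Adj Γ (t i) y → ⊥
        no-neighbour y∈ t~y with t-neighbour t~y (matched-on-cycle y∈)
        ... | inj₁ refl       = u∉cycle i y∈
        ... | inj₂ (j , refl) = ℓ∉cycle j y∈

    off-cycle : ∀ {y} → Matched y → y ∉ verts
    off-cycle (t-matched i) = t∉cycle i
    off-cycle (u-matched i) = u∉cycle i
    off-cycle (v-matched j) = v∉cycle j
    off-cycle (ℓ-matched j) = ℓ∉cycle j

  M₀-acyclic : ¬ Cycle (Adj Γ) (_∈ endpoints M₀)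
  M₀-acyclic C = off-cycle (matched-on-cycle first∈) first∈
    where
      open OnCycle C
      first∈ : Cycle.first C ∈ Cycle.verts C
      first∈ = head∈path (Cycle.path C)

first-literal : ∀ {n m} {Γ : CNF n m} → Restricted Γ → (j : Fin m) → Fin (length (Γ j))
first-literal {Γ = Γ} R j with Restricted.size23 R j
... | inj₁ two   = subst Fin (sym two) zero
... | inj₂ three = subst Fin (sym three) zero

lemma1 : (n m : ℕ) (Γ : CNF n m) → Restricted Γ → νac≡ (Adj Γ) (n + m)
lemma1 n m Γ R = (M₀ , (M₀-matching , M₀-acyclic) , length-M₀) , acyclic-matching-length≤
  where open Matching {Γ = Γ} (first-literal R)
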